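{- For every nonnegative integer $n$: let $GG_2(n)$ denote the number of partitions of $n$ with all parts at least $3$ in which any two consecutive parts differ by at least $2$, and by at least $4$ if both are even. Let $GG_{ -2}(n)$ denote the number of signed partitions of $n$ in which the positive parts are even and each at least $2(\ell^++1)$, and the negative parts are odd, distinct and each at most $2\ell^+$. Let $GG'_{ -2}(n)$ denote the number of signed partitions of $n$ in which the positive parts are at least $4$, even and differ pairwise by at least $4$, and the negative parts are odd, distinct and each at most $2\ell^+-1$. Here $\ell^+$ is the number of positive parts of the signed partition. Then $GG_2(n)=GG_{ -2}(n)=GG'_{ -2}(n)$ for all $n\ge 0$.
   Context: A partition of an integer $n$ is a finite nonincreasing sequence of positive integers (its parts) summing to $n$. A signed partition of an integer $n$ is a pair $(\pi,\nu)$ of ordinary partitions with $|\pi|-|\nu|=n$, where $|\cdot|$ denotes the sum of parts; the parts of $\pi$ are the positive parts and the parts of $\nu$ are the negative parts (their sizes). $\ell^+$ denotes the number of positive parts of a signed partition. -}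

module Defs where

open import Data.Nat using (ℕ; zero; suc; _+_; _*_; _≤_; _<_; _≥_; _>_)
open import Data.Nat.Divisibility using (_∣_)
open import Data.List using (List; []; _∷_; length)
open import Data.Nat.ListAction using (sum)
open import Data.List.Relation.Unary.All using (All)
open import Data.List.Relation.Unary.Linked using (Linked)
open import Data.List.Relation.Unary.AllPairs using (AllPairs)
open import Data.List.Relation.Unary.Unique.Propositional using (Unique)
open import Data.List.Membership.Propositional using (_∈_)
open import Data.Product using (Σ; _×_; _,_)
open import Relation.Nullary using (¬_)
open import Relation.Binary.PropositionalEquality using (_≡_)

Even : ℕ → Set
Even m = 2 ∣ m

Odd : ℕ → Set
Odd m = ¬ (2 ∣ m)

IsPartition : List ℕ → Set
IsPartition xs = All (λ p → 1 ≤ p) xs × Linked _≥_ xs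

PartitionOf : ℕ → List ℕ → Set
PartitionOf n xs = IsPartition xs × sum xs ≡ n

-- A signed partition (π , ν) of n : |π| - |ν| = n, i.e. |π| = n + |ν|.
SignedPartition : Set
SignedPartition = List ℕ × List ℕ

SignedPartitionOf : ℕ → SignedPartition → Set
SignedPartitionOf n (π , ν) = IsPartition π × IsPartition ν × sum π ≡ n + sum ν

ℓ⁺ : SignedPartition → ℕ
ℓ⁺ (π , ν) = length π

HasCount : {A : Set} → (A → Set) → ℕ → Set
HasCount {A} P k =
  Σ (List A) λ xs → Unique xs × (∀ x → (x ∈ xs → P x) × (P x → x ∈ xs)) × length xs ≡ k

GapCond : ℕ → ℕ → Set
GapCond a b = (b + 2 ≤ a) × (Even a → Even b → b + 4 ≤ a)

IsGG₂ : ℕ → List ℕ → Set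
IsGG₂ n xs = PartitionOf n xs × All (λ p → 3 ≤ p) xs × Linked GapCond xs

IsGG₋₂ : ℕ → SignedPartition → Set
IsGG₋₂ n (π , ν) =
  SignedPartitionOf n (π , ν)
  × All (λ p → Even p × 2 * (length π + 1) ≤ p) π
  × All (λ q → Odd q × q ≤ 2 * length π) ν
  × Unique ν

IsGG'₋₂ : ℕ → SignedPartition → Set
IsGG'₋₂ n (π , ν) =
  SignedPartitionOf n (π , ν)
  × All (λ p → 4 ≤ p × Even p) π
  × AllPairs (λ a b → b + 4 ≤ a) π
  × All (λ q → Odd q × q + 1 ≤ 2 * length π) ν
  × Unique ν

-- A partition λ₁ ≥ ⋯ ≥ λₗ counted by GG₂ is sent to the signed partition whose negative parts
-- are the numbers 2i − 1 with λᵢ odd and whose i-th positive part is λᵢ + [λᵢ odd] plus twice the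
-- number of odd parts after λᵢ; the amounts added are exactly the negative parts. Consecutive
-- positive parts then differ by λᵢ − λᵢ₊₁ + [λᵢ odd] + [λᵢ₊₁ odd], which is at least 4 precisely
-- when λᵢ, λᵢ₊₁ satisfy the GG₂ gap condition, and the map is inverted part by part, reading
-- [λᵢ odd] off whether the smallest remaining negative part is 1. This gives GG₂(n) = GG'₋₂(n).
-- Subtracting the staircase 4l, 4(l − 1), …, 4 from the positive parts and adding 2(l + 1) to each
-- turns "parts ≥ 4 and gaps ≥ 4" into "nonincreasing with parts ≥ 2(l + 1)" without changing the
-- sum, since 4 + 8 + ⋯ + 4l = l · 2(l + 1); for odd q, q ≤ 2l − 1 iff q ≤ 2l. A count is a duplicate-free enumeration, which such bijections transport,
-- and GG₂(n) is enumerated by filtering the lists of length at most n with parts at most n.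

module Submission where

open import Defs
open import Data.Empty using (⊥-elim)
open import Data.List
  using ( List; []; _∷_; length; map; filter; deduplicate; replicate; _++_
        ; upTo; applyDownFrom; cartesianProductWith)
open import Data.List.Properties using (length-map; length-++; length-replicate; ≡-dec)
open import Data.List.Membership.Propositional using (_∈_)
open import Data.List.Membership.Propositional.Properties
  using (∈-filter⁺; ∈-filter⁻; ∈-deduplicate⁺; ∈-map⁺; ∈-map⁻; ∈-upTo⁺; ∈-cartesianProductWith⁺)
open import Data.List.Relation.Unary.All as All using (All; []; _∷_; all?)
import Data.List.Relation.Unary.All.Properties as All
open import Data.List.Relation.Unary.AllPairs as AllPairs using (AllPairs; []; _∷_)
import Data.List.Relation.Unary.AllPairs.Properties as AllPairs
open import Data.List.Relation.Unary.Any using (here; there)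
open import Data.List.Relation.Unary.Linked as Linked using (Linked; []; [-]; _∷_; linked?)
import Data.List.Relation.Unary.Linked.Properties as Linked
open import Data.List.Relation.Unary.Unique.Propositional using (Unique)
import Data.List.Relation.Unary.Unique.Propositional.Properties as Unique
open import Data.List.Relation.Unary.Unique.DecPropositional.Properties using (deduplicate-!)
open import Data.Nat using (ℕ; zero; suc; _+_; _*_; _∸_; _%_; _≤_; _<_; _>_; _≥_; _≤?_; z≤n; s≤s; s≤s⁻¹)
open import Data.Nat.Properties
open import Data.Nat.DivMod using ([m+n]%n≡m%n; [m+kn]%n≡m%n)
open import Data.Nat.Divisibility
  using (_∣?_; divides; ∣-refl; ∣-trans; m∣m*n; ∣m∣n⇒∣m+n; ∣m+n∣m⇒∣n; >⇒∤; m%n≡0⇒n∣m; n∣m⇒m%n≡0)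
open import Data.Nat.ListAction using (sum)
open import Data.Nat.Tactic.RingSolver using (solve-∀)
open import Data.Product using (Σ; _×_; _,_; proj₁; proj₂; ∃₂; map₁; uncurry)
open import Data.Sum using (_⊎_; inj₁; inj₂)
open import Data.Unit using (⊤; tt)
open import Function using (_⇔_; mk⇔; Equivalence)
open import Relation.Nullary using (¬_)
open import Relation.Nullary.Decidable using (Dec; _×-dec_; _→-dec_)
open import Relation.Unary using (Decidable)
open import Relation.Binary.Definitions using (DecidableEquality; Transitive)
open import Relation.Binary.PropositionalEquality
  using (_≡_; _≢_; refl; sym; trans; cong; cong₂; subst; subst₂; module ≡-Reasoning)

hasCount-decidable : {A : Set} {P : A → Set} → Decidable P → DecidableEquality A →
                     (xs : List A) → (∀ {x} → P x → x ∈ xs) → Σ ℕ (HasCount P)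
hasCount-decidable P? _≟_ xs P⊆xs =
  length ys , ys , Unique.filter⁺ P? {deduplicate _≟_ xs} (deduplicate-! _≟_ xs) ,
  (λ x → (λ x∈ys → proj₂ (∈-filter⁻ P? {xs = deduplicate _≟_ xs} x∈ys)) ,
         (λ px → ∈-filter⁺ P? (∈-deduplicate⁺ _≟_ (P⊆xs px)) px)) ,
  refl
  where ys = filter P? (deduplicate _≟_ xs)

record BijectionBetween {A B : Set} (P : A → Set) (Q : B → Set) : Set where
  field
    to      : A → B
    from    : B → A
    to-P    : ∀ {x} → P x → Q (to x)
    from-Q  : ∀ {y} → Q y → P (from y)
    from∘to : ∀ {x} → P x → from (to x) ≡ x
    to∘from : ∀ {y} → Q y → to (from y) ≡ y

  to-injective : ∀ {x x′} → P x → P x′ → to x ≡ to x′ → x ≡ x′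
  to-injective px px′ eq = trans (sym (from∘to px)) (trans (cong from eq) (from∘to px′))

  map-to-unique : ∀ {xs} → All P xs → Unique xs → Unique (map to xs)
  map-to-unique [] [] = []
  map-to-unique (px ∷ pxs) (x∉xs ∷ xs!) =
    All.map⁺ (All.zipWith (λ (px′ , x≢x′) eq → x≢x′ (to-injective px px′ eq)) (pxs , x∉xs))
    ∷ map-to-unique pxs xs!

  hasCount-transfer : ∀ {k} → HasCount P k → HasCount Q k
  hasCount-transfer (xs , xs! , xs⇔P , |xs|≡k) =
    map to xs , map-to-unique (All.tabulate (λ {x} → proj₁ (xs⇔P x))) xs! ,
    (λ y → (λ y∈ → let (x , x∈xs , y≡tox) = ∈-map⁻ to y∈ in
                   subst Q (sym y≡tox) (to-P (proj₁ (xs⇔P x) x∈xs))) ,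
           (λ qy → subst (_∈ map to xs) (to∘from qy) (∈-map⁺ to (proj₂ (xs⇔P (from y)) (from-Q qy))))) ,
    trans (length-map to xs) |xs|≡k

boundedLists : (bound maxLength : ℕ) → List (List ℕ)
boundedLists b zero    = [] ∷ []
boundedLists b (suc m) = [] ∷ cartesianProductWith _∷_ (upTo b) (boundedLists b m)

∈-boundedLists : ∀ {b} m {xs} → length xs ≤ m → All (_< b) xs → xs ∈ boundedLists b m
∈-boundedLists zero    {[]}     _            _            = here refl
∈-boundedLists (suc m) {[]}     _            _            = here refl
∈-boundedLists (suc m) {x ∷ xs} (s≤s |xs|≤m) (x<b ∷ xs<b) =
  there (∈-cartesianProductWith⁺ _∷_ (∈-upTo⁺ x<b) (∈-boundedLists m |xs|≤m xs<b))

length≤sum : ∀ {xs} → All (1 ≤_) xs → length xs ≤ sum xs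
length≤sum []           = z≤n
length≤sum (1≤x ∷ 1≤xs) = +-mono-≤ 1≤x (length≤sum 1≤xs)

All-≤-sum : ∀ xs → All (_≤ sum xs) xs
All-≤-sum []       = []
All-≤-sum (x ∷ xs) = m≤m+n x (sum xs) ∷ All.map (λ y≤ → ≤-trans y≤ (m≤n+m (sum xs) x)) (All-≤-sum xs)

partitionOf-∈-boundedLists : ∀ {n xs} → PartitionOf n xs → xs ∈ boundedLists (suc n) n
partitionOf-∈-boundedLists {xs = xs} ((parts≥1 , _) , refl) =
  ∈-boundedLists (sum xs) (length≤sum parts≥1) (All.map s≤s (All-≤-sum xs))

isGG₂? : ∀ n xs → Dec (IsGG₂ n xs)
isGG₂? n xs =
  ((all? (1 ≤?_) xs ×-dec linked? (λ x y → y ≤? x) xs) ×-dec sum xs ≟ n)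
  ×-dec (all? (3 ≤?_) xs ×-dec linked? gapCond? xs)
  where
  gapCond? : ∀ a b → Dec (GapCond a b)
  gapCond? a b = (b + 2 ≤? a) ×-dec (2 ∣? a →-dec (2 ∣? b →-dec (b + 4 ≤? a)))

GG₂-hasCount : ∀ n → Σ ℕ (HasCount (IsGG₂ n))
GG₂-hasCount n = hasCount-decidable (isGG₂? n) (≡-dec _≟_) (boundedLists (suc n) n)
                   (λ (partition , _) → partitionOf-∈-boundedLists partition)

parity-cases : ∀ x → x % 2 ≡ 0 ⊎ x % 2 ≡ 1
parity-cases zero          = inj₁ refl
parity-cases (suc zero)    = inj₂ refl
parity-cases (suc (suc x)) = parity-cases x

%2≤1 : ∀ x → x % 2 ≤ 1
%2≤1 x with parity-cases x
... | inj₁ r≡0 = subst (_≤ 1) (sym r≡0) z≤n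
... | inj₂ r≡1 = subst (_≤ 1) (sym r≡1) ≤-refl

[m+m%2]%2≡0 : ∀ m → (m + m % 2) % 2 ≡ 0
[m+m%2]%2≡0 zero          = refl
[m+m%2]%2≡0 (suc zero)    = refl
[m+m%2]%2≡0 (suc (suc m)) = [m+m%2]%2≡0 m

even-+%2 : ∀ m → Even (m + m % 2)
even-+%2 m = m%n≡0⇒n∣m (m + m % 2) 2 ([m+m%2]%2≡0 m)

[m+b]%2≡0⇒m%2≡b : ∀ m {b} → b ≤ 1 → (m + b) % 2 ≡ 0 → m % 2 ≡ b
[m+b]%2≡0⇒m%2≡b zero          z≤n       _ = refl
[m+b]%2≡0⇒m%2≡b (suc zero)    (s≤s z≤n) _ = refl
[m+b]%2≡0⇒m%2≡b (suc (suc m)) b≤1       e = [m+b]%2≡0⇒m%2≡b m b≤1 e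
[m+b]%2≡0⇒m%2≡b zero          (s≤s z≤n) ()
[m+b]%2≡0⇒m%2≡b (suc zero)    z≤n       ()

odd-1 : Odd 1
odd-1 = >⇒∤ (s≤s (s≤s z≤n))

odd-2+ : ∀ {q} → Odd q → Odd (2 + q)
odd-2+ odd-q 2∣2+q = odd-q (∣m+n∣m⇒∣n 2∣2+q ∣-refl)

odd-2+⁻ : ∀ {q} → Odd (2 + q) → Odd q
odd-2+⁻ odd-2+q 2∣q = odd-2+q (∣m∣n⇒∣m+n ∣-refl 2∣q)

¬odd-0 : ¬ Odd 0
¬odd-0 odd-0 = odd-0 (m%n≡0⇒n∣m 0 2 refl)

odd⇒positive : ∀ {q} → Odd q → 1 ≤ q
odd⇒positive {zero}  odd-0 = ⊥-elim (¬odd-0 odd-0)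
odd⇒positive {suc q} _     = s≤s z≤n

odd-≤-2* : ∀ {q} l → Odd q → q ≤ 2 * l → q + 1 ≤ 2 * l
odd-≤-2* {q} l odd-q q≤2l with m≤n⇒m<n∨m≡n q≤2l
... | inj₁ q<2l  = subst (_≤ 2 * l) (+-comm 1 q) q<2l
... | inj₂ refl = ⊥-elim (odd-q (m∣m*n l))

3≤⇒4≤+%2 : ∀ {x} → 3 ≤ x → 4 ≤ x + x % 2
3≤⇒4≤+%2 {x} 3≤x with parity-cases x | m≤n⇒m<n∨m≡n 3≤x
... | inj₁ r≡0 | inj₁ 3<x  = ≤-trans 3<x (m≤m+n x _)
... | inj₁ ()  | inj₂ refl
... | inj₂ r≡1 | _         = subst (λ r → 4 ≤ x + r) (sym r≡1) (subst (4 ≤_) (+-comm 1 x) (s≤s 3≤x))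

4≤+%2⇒3≤ : ∀ {x} → 4 ≤ x + x % 2 → 3 ≤ x
4≤+%2⇒3≤ {x} 4≤ = +-cancelʳ-≤ 1 3 x (≤-trans 4≤ (+-monoʳ-≤ x (%2≤1 x)))

different-parity-gap : ∀ {x y} → y + 2 ≤ x → x % 2 ≢ y % 2 → y + 4 ≤ x + 1
different-parity-gap {x} {y} y+2≤x x≢y with m≤n⇒m<n∨m≡n y+2≤x
... | inj₁ y+2<x = subst (_≤ x + 1) (+-assoc y 3 1) (+-monoˡ-≤ 1 (subst (_≤ x) (sym (+-suc y 2)) y+2<x))
... | inj₂ refl  = ⊥-elim (x≢y ([m+n]%n≡m%n y 2))

gapCond⇒ : ∀ {x y} → GapCond x y → y + 4 ≤ x + x % 2 + y % 2
gapCond⇒ {x} {y} (y+2≤x , evens) with parity-cases x | parity-cases y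
... | inj₁ rx≡0 | inj₁ ry≡0 =
  ≤-trans (evens (m%n≡0⇒n∣m x 2 rx≡0) (m%n≡0⇒n∣m y 2 ry≡0)) (≤-trans (m≤m+n x _) (m≤m+n _ _))
... | inj₂ rx≡1 | inj₂ ry≡1 = subst₂ (λ r s → y + 4 ≤ x + r + s) (sym rx≡1) (sym ry≡1) (begin
  y + 4      ≡⟨ +-assoc y 2 2 ⟨
  y + 2 + 2  ≤⟨ +-monoˡ-≤ 2 y+2≤x ⟩
  x + 2      ≡⟨ +-assoc x 1 1 ⟨
  x + 1 + 1  ∎)
  where open ≤-Reasoning
... | inj₁ rx≡0 | inj₂ ry≡1 = subst₂ (λ r s → y + 4 ≤ x + r + s) (sym rx≡0) (sym ry≡1)
  (subst (y + 4 ≤_) (cong (_+ 1) (sym (+-identityʳ x)))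
    (different-parity-gap y+2≤x (λ rx≡ry → 0≢1+n (trans (sym rx≡0) (trans rx≡ry ry≡1)))))
... | inj₂ rx≡1 | inj₁ ry≡0 = subst₂ (λ r s → y + 4 ≤ x + r + s) (sym rx≡1) (sym ry≡0)
  (subst (y + 4 ≤_) (sym (+-identityʳ (x + 1)))
    (different-parity-gap y+2≤x (λ rx≡ry → 0≢1+n (trans (sym ry≡0) (trans (sym rx≡ry) rx≡1)))))

gapCond⇐ : ∀ {x y} → y + 4 ≤ x + x % 2 + y % 2 → GapCond x y
gapCond⇐ {x} {y} y+4≤ = y+2≤x , evens
  where
  y+2≤x : y + 2 ≤ x
  y+2≤x = +-cancelʳ-≤ 2 (y + 2) x (begin
    y + 2 + 2           ≡⟨ +-assoc y 2 2 ⟩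
    y + 4               ≤⟨ y+4≤ ⟩
    x + x % 2 + y % 2   ≤⟨ +-mono-≤ (+-monoʳ-≤ x (%2≤1 x)) (%2≤1 y) ⟩
    x + 1 + 1           ≡⟨ +-assoc x 1 1 ⟩
    x + 2               ∎)
    where open ≤-Reasoning
  evens : Even x → Even y → y + 4 ≤ x
  evens 2∣x 2∣y =
    subst (y + 4 ≤_) (trans (+-identityʳ (x + 0)) (+-identityʳ x))
      (subst₂ (λ r s → y + 4 ≤ x + r + s) (n∣m⇒m%n≡0 x 2 2∣x) (n∣m⇒m%n≡0 y 2 2∣y) y+4≤)

-- Shifting parts against a staircase

Gap : ℕ → ℕ → ℕ → Set
Gap d p q = q + d ≤ p

Gap-trans : ∀ {d} → Transitive (Gap d)
Gap-trans {d} {p} {q} {r} q+d≤p r+d≤q = ≤-trans r+d≤q (≤-trans (m≤m+n q d) q+d≤p)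

Gap⇒≥ : ∀ {d p q} → Gap d p q → p ≥ q
Gap⇒≥ {d} {q = q} q+d≤p = ≤-trans (m≤m+n q d) q+d≤p

≥⇒Gap0 : ∀ {p q} → p ≥ q → Gap 0 p q
≥⇒Gap0 {p} {q} q≤p = subst (_≤ p) (sym (+-identityʳ q)) q≤p

Above : (ℕ → ℕ) → List ℕ → Set
Above a []       = ⊤
Above a (p ∷ ps) = a (length ps) ≤ p × Above a ps

rebase : (a b : ℕ → ℕ) → List ℕ → List ℕ
rebase a b []       = []
rebase a b (p ∷ ps) = p ∸ a (length ps) + b (length ps) ∷ rebase a b ps

module _ (a b : ℕ → ℕ) where

  length-rebase : ∀ ps → length (rebase a b ps) ≡ length ps
  length-rebase []       = refl
  length-rebase (p ∷ ps) = cong suc (length-rebase ps)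

  rebase-Above : ∀ ps → Above b (rebase a b ps)
  rebase-Above []       = tt
  rebase-Above (p ∷ ps) =
    subst (λ j → b j ≤ p ∸ a (length ps) + b (length ps)) (sym (length-rebase ps)) (m≤n+m _ _) ,
    rebase-Above ps

  rebase-rebase : ∀ {ps} → Above a ps → rebase b a (rebase a b ps) ≡ ps
  rebase-rebase {[]}     _             = refl
  rebase-rebase {p ∷ ps} (a≤p , above) = cong₂ _∷_ head-restored (rebase-rebase above)
    where
    j = length ps
    head-restored : p ∸ a j + b j ∸ b (length (rebase a b ps)) + a (length (rebase a b ps)) ≡ p
    head-restored rewrite length-rebase ps | m+n∸n≡m (p ∸ a j) (b j) = m∸n+n≡m a≤p

  sum-rebase : ∀ {ps} → Above a ps →
    sum (rebase a b ps) + sum (applyDownFrom a (length ps)) ≡ sum ps + sum (applyDownFrom b (length ps))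
  sum-rebase {[]}     _             = refl
  sum-rebase {p ∷ ps} (a≤p , above) = begin
    p ∸ a j + b j + sum (rebase a b ps) + (a j + sum (applyDownFrom a j))
      ≡⟨ regroup (p ∸ a j) (a j) (b j) _ _ ⟩
    (p ∸ a j + a j) + b j + (sum (rebase a b ps) + sum (applyDownFrom a j))
      ≡⟨ cong₂ (λ u v → u + b j + v) (m∸n+n≡m a≤p) (sum-rebase above) ⟩
    p + b j + (sum ps + sum (applyDownFrom b j))
      ≡⟨ regroup′ p (b j) (sum ps) _ ⟩
    p + sum ps + (b j + sum (applyDownFrom b j)) ∎
    where
    open ≡-Reasoning
    j = length ps
    regroup : ∀ u v w r s → u + w + r + (v + s) ≡ (u + v) + w + (r + s)
    regroup = solve-∀
    regroup′ : ∀ p w r s → p + w + (r + s) ≡ p + r + (w + s)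
    regroup′ = solve-∀

  rebase-even : (∀ j → Even (a j)) → (∀ j → Even (b j)) →
                ∀ {ps} → Above a ps → All Even ps → All Even (rebase a b ps)
  rebase-even even-a even-b {[]}     _             []           = []
  rebase-even even-a even-b {p ∷ ps} (a≤p , above) (even-p ∷ evens) =
    ∣m∣n⇒∣m+n (∣m+n∣m⇒∣n (subst Even (sym (m+[n∸m]≡n a≤p)) even-p) (even-a j)) (even-b j)
    ∷ rebase-even even-a even-b above evens
    where j = length ps

  rebase-gaps : ∀ {α β} → (∀ j → a (suc j) ≡ α + a j) → (∀ j → b (suc j) ≡ β + b j) →
                ∀ {ps} → Linked (Gap α) ps → Linked (Gap β) (rebase a b ps)
  rebase-gaps a-step b-step []                         = []
  rebase-gaps a-step b-step [-]                        = [-]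
  rebase-gaps {α} {β} a-step b-step {p ∷ q ∷ qs} (q+α≤p ∷ gaps) =
    gap ∷ rebase-gaps a-step b-step gaps
    where
    open ≤-Reasoning
    j = length qs
    gap : q ∸ a j + b j + β ≤ p ∸ a (suc j) + b (suc j)
    gap = begin
      q ∸ a j + b j + β          ≡⟨ +-assoc (q ∸ a j) (b j) β ⟩
      q ∸ a j + (b j + β)        ≡⟨ cong (q ∸ a j +_) (+-comm (b j) β) ⟩
      q ∸ a j + (β + b j)        ≡⟨ cong (_+ (β + b j)) ([m+n]∸[m+o]≡n∸o α q (a j)) ⟨
      α + q ∸ (α + a j) + (β + b j)
        ≤⟨ +-monoˡ-≤ (β + b j) (∸-monoˡ-≤ (α + a j) (subst (_≤ p) (+-comm q α) q+α≤p)) ⟩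
      p ∸ (α + a j) + (β + b j)  ≡⟨ cong₂ (λ u v → p ∸ u + v) (a-step j) (b-step j) ⟨
      p ∸ a (suc j) + b (suc j)  ∎

stair : ℕ → ℕ
stair j = 4 * suc j

stair-suc : ∀ j → stair (suc j) ≡ 4 + stair j
stair-suc j = *-suc 4 (suc j)

even-stair : ∀ j → Even (stair j)
even-stair j = ∣-trans (divides 2 refl) (m∣m*n (suc j))

level : ℕ → ℕ
level l = 2 * (l + 1)

even-level : ∀ l → Even (level l)
even-level l = m∣m*n (l + 1)

1≤level : ∀ l → 1 ≤ level l
1≤level l = ≤-trans (s≤s z≤n) (*-monoʳ-≤ 2 (m≤n+m 1 l))

sum-stairs : ∀ l → sum (applyDownFrom stair l) ≡ l * level l
sum-stairs zero    = refl
sum-stairs (suc l) = trans (cong (stair l +_) (sum-stairs l)) (gauss l)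
  where
  gauss : ∀ l → 4 * suc l + l * (2 * (l + 1)) ≡ suc l * (2 * (suc l + 1))
  gauss = solve-∀

sum-levels : ∀ c l → sum (applyDownFrom (λ _ → c) l) ≡ l * c
sum-levels c zero    = refl
sum-levels c (suc l) = cong (c +_) (sum-levels c l)

stairs-balance : ∀ l → sum (applyDownFrom stair l) ≡ sum (applyDownFrom (λ _ → level l) l)
stairs-balance l = trans (sum-stairs l) (sym (sum-levels (level l) l))

Above-const⇒All : ∀ {c ps} → Above (λ _ → c) ps → All (c ≤_) ps
Above-const⇒All {ps = []}    _             = []
Above-const⇒All {ps = _ ∷ _} (c≤p , above) = c≤p ∷ Above-const⇒All above

All⇒Above-const : ∀ {c ps} → All (c ≤_) ps → Above (λ _ → c) ps
All⇒Above-const []           = tt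
All⇒Above-const (c≤p ∷ c≤ps) = c≤p , All⇒Above-const c≤ps

Above-stair⇒All : ∀ {ps} → Above stair ps → All (4 ≤_) ps
Above-stair⇒All {[]}     _                 = []
Above-stair⇒All {_ ∷ ps} (stair≤p , above) =
  ≤-trans (m≤m*n 4 (suc (length ps))) stair≤p ∷ Above-stair⇒All above

gaps⇒Above-stair : ∀ {ps} → Linked (Gap 4) ps → All (4 ≤_) ps → Above stair ps
gaps⇒Above-stair []  []            = tt
gaps⇒Above-stair [-] (4≤p ∷ [])    = 4≤p , tt
gaps⇒Above-stair {p ∷ q ∷ qs} (q+4≤p ∷ gaps) (_ ∷ fours)
  with gaps⇒Above-stair gaps fours
... | stair≤q , above = stair≤p , stair≤q , above
  where
  stair≤p : stair (suc (length qs)) ≤ p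
  stair≤p = ≤-trans (≤-reflexive (trans (stair-suc (length qs)) (+-comm 4 _)))
                    (≤-trans (+-monoˡ-≤ 4 stair≤q) q+4≤p)

-- Sets of small odd numbers as negative parts

shift : ℕ → List ℕ → List ℕ
shift b ν = map (2 +_) ν ++ replicate b 1

-- Inverse of shift on OddSubsets; the last clause is meant for a final part 1.
unshift : List ℕ → List ℕ × ℕ
unshift []                 = [] , 0
unshift (suc (suc q) ∷ qs) = map₁ (q ∷_) (unshift qs)
unshift (_ ∷ _)            = [] , 1

unshift-shift : ∀ ν {b} → b ≤ 1 → unshift (shift b ν) ≡ (ν , b)
unshift-shift []      z≤n       = refl
unshift-shift []      (s≤s z≤n) = refl
unshift-shift (q ∷ ν) b≤1       = cong (map₁ (q ∷_)) (unshift-shift ν b≤1)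

length-shift : ∀ b ν → length (shift b ν) ≡ length ν + b
length-shift b ν =
  trans (length-++ (map (2 +_) ν)) (cong₂ _+_ (length-map (2 +_) ν) (length-replicate b))

sum-shift : ∀ b ν → sum (shift b ν) ≡ 2 * length ν + sum ν + b
sum-shift b []      = sum-ones b
  where
  sum-ones : ∀ b → sum (replicate b 1) ≡ b
  sum-ones zero    = refl
  sum-ones (suc b) = cong suc (sum-ones b)
sum-shift b (q ∷ ν) = trans (cong (2 + q +_) (sum-shift b ν)) (regroup q (length ν) (sum ν) b)
  where
  regroup : ∀ q k s b → 2 + q + (2 * k + s + b) ≡ 2 * suc k + (q + s) + b
  regroup = solve-∀

OddSubset : ℕ → List ℕ → Set
OddSubset l ν = AllPairs _>_ ν × All (λ q → Odd q × q + 1 ≤ 2 * l) ν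

shift-OddSubset : ∀ {l ν b} → b ≤ 1 → OddSubset l ν → OddSubset (suc l) (shift b ν)
shift-OddSubset {l} {ν} {b} b≤1 (decreasing , bounded) =
  AllPairs.++⁺ (AllPairs.map⁺ (AllPairs.map (λ q′<q → s≤s (s≤s q′<q)) decreasing)) (ones b≤1)
    (All.map⁺ (All.tabulate (λ _ → All.replicate⁺ b (s≤s (s≤s z≤n))))) ,
  All.++⁺ (All.map⁺ (All.map (λ (odd-q , q+1≤2l) → odd-2+ odd-q , raise (s≤s (s≤s q+1≤2l))) bounded))
          (All.replicate⁺ b (odd-1 , raise (s≤s (s≤s z≤n))))
  where
  raise : ∀ {m} → m ≤ 2 + 2 * l → m ≤ 2 * suc l
  raise {m} = subst (m ≤_) (sym (*-suc 2 l))
  ones : ∀ {b} → b ≤ 1 → AllPairs _>_ (replicate b 1)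
  ones z≤n       = []
  ones (s≤s z≤n) = [] ∷ []

OddSubset-zero : ∀ {ν} → OddSubset 0 ν → ν ≡ []
OddSubset-zero {[]}    _                        = refl
OddSubset-zero {q ∷ _} (_ , (_ , q+1≤0) ∷ _) with () ← ≤-trans (m≤n+m 1 q) q+1≤0

OddSubset-shift⁻ : ∀ {l} ν → OddSubset (suc l) ν →
                   ∃₂ λ ν′ b → b ≤ 1 × OddSubset l ν′ × ν ≡ shift b ν′
OddSubset-shift⁻ [] _ = [] , 0 , z≤n , ([] , []) , refl
OddSubset-shift⁻ (zero ∷ _) (_ , (odd-0 , _) ∷ _) = ⊥-elim (¬odd-0 odd-0)
OddSubset-shift⁻ (suc zero ∷ []) _ = [] , 1 , ≤-refl , ([] , []) , refl
OddSubset-shift⁻ (suc zero ∷ zero ∷ _) (_ , _ ∷ (odd-0 , _) ∷ _) = ⊥-elim (¬odd-0 odd-0)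
OddSubset-shift⁻ (suc zero ∷ suc q ∷ _) (((s≤s ()) ∷ _) ∷ _ , _)
OddSubset-shift⁻ {l} (suc (suc q) ∷ qs) (q>qs ∷ decreasing , (odd-2+q , bound) ∷ bounded)
  with OddSubset-shift⁻ qs (decreasing , bounded)
... | ν′ , b , b≤1 , (decreasing′ , bounded′) , refl =
  q ∷ ν′ , b , b≤1 ,
  (All.map (λ 2+q′<2+q → s≤s⁻¹ (s≤s⁻¹ 2+q′<2+q)) (All.map⁻ (All.++⁻ˡ (map (2 +_) ν′) q>qs))
     ∷ decreasing′ ,
   (odd-2+⁻ odd-2+q , s≤s⁻¹ (s≤s⁻¹ (subst (2 + q + 1 ≤_) (*-suc 2 l) bound))) ∷ bounded′) ,
  refl

length-OddSubset : ∀ l {ν} → OddSubset l ν → length ν ≤ l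
length-OddSubset zero    oddSubset = subst (λ ν → length ν ≤ 0) (sym (OddSubset-zero oddSubset)) z≤n
length-OddSubset (suc l) {ν} oddSubset with OddSubset-shift⁻ ν oddSubset
... | ν′ , b , b≤1 , oddSubset′ , refl =
  subst (_≤ suc l) (sym (length-shift b ν′))
    (subst (length ν′ + b ≤_) (+-comm l 1) (+-mono-≤ (length-OddSubset l oddSubset′) b≤1))

decreasing⇒nonincreasing : ∀ {ν} → AllPairs _>_ ν → Linked _≥_ ν
decreasing⇒nonincreasing decreasing = Linked.AllPairs⇒Linked (AllPairs.map <⇒≤ decreasing)

decreasing⇒unique : ∀ {ν} → AllPairs _>_ ν → Unique ν
decreasing⇒unique = AllPairs.map (λ q′<q q≡q′ → <⇒≢ q′<q (sym q≡q′))

nonincreasing-unique⇒decreasing : ∀ {ν} → Linked _≥_ ν → Unique ν → AllPairs _>_ ν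
nonincreasing-unique⇒decreasing nonincreasing unique =
  AllPairs.zipWith (λ (q′≤q , q≢q′) → ≤∧≢⇒< q′≤q (λ q′≡q → q≢q′ (sym q′≡q)))
    (Linked.Linked⇒AllPairs (λ y≤x z≤y → ≤-trans z≤y y≤x) nonincreasing , unique)

-- GG₂(n) = GG'₋₂(n)

negatives : List ℕ → List ℕ
negatives []       = []
negatives (x ∷ xs) = shift (x % 2) (negatives xs)

positives : List ℕ → List ℕ
positives []       = []
positives (x ∷ xs) = x + x % 2 + 2 * length (negatives xs) ∷ positives xs

toSigned : List ℕ → SignedPartition
toSigned xs = positives xs , negatives xs

fromSigned : List ℕ → List ℕ → List ℕ
fromSigned []      _ = []
fromSigned (p ∷ π) ν = let (ν′ , b) = unshift ν in p ∸ (b + 2 * length ν′) ∷ fromSigned π ν′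

length-positives : ∀ xs → length (positives xs) ≡ length xs
length-positives []       = refl
length-positives (x ∷ xs) = cong suc (length-positives xs)

sum-positives : ∀ xs → sum (positives xs) ≡ sum xs + sum (negatives xs)
sum-positives []       = refl
sum-positives (x ∷ xs) = begin
  x + r + 2 * k + sum (positives xs)   ≡⟨ cong (x + r + 2 * k +_) (sum-positives xs) ⟩
  x + r + 2 * k + (sum xs + sum ν)     ≡⟨ regroup x r k (sum xs) (sum ν) ⟩
  x + sum xs + (2 * k + sum ν + r)     ≡⟨ cong (x + sum xs +_) (sum-shift r ν) ⟨
  x + sum xs + sum (shift r ν)         ∎
  where
  open ≡-Reasoning
  r = x % 2
  ν = negatives xs
  k = length ν
  regroup : ∀ x r k s t → x + r + 2 * k + (s + t) ≡ x + s + (2 * k + t + r)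
  regroup = solve-∀

negatives-OddSubset : ∀ xs → OddSubset (length xs) (negatives xs)
negatives-OddSubset []       = [] , []
negatives-OddSubset (x ∷ xs) = shift-OddSubset (%2≤1 x) (negatives-OddSubset xs)

positives-even : ∀ xs → All Even (positives xs)
positives-even []       = []
positives-even (x ∷ xs) = ∣m∣n⇒∣m+n (even-+%2 x) (m∣m*n (length (negatives xs))) ∷ positives-even xs

gap-lift : ∀ x y rx ry k → y + 4 ≤ x + rx + ry ⇔ y + ry + 2 * k + 4 ≤ x + rx + 2 * (k + ry)
gap-lift x y rx ry k = mk⇔
  (λ le → subst₂ _≤_ (lhs y ry k) (rhs x rx ry k) (+-monoˡ-≤ (ry + 2 * k) le))
  (λ le → +-cancelʳ-≤ (ry + 2 * k) (y + 4) (x + rx + ry)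
            (subst₂ _≤_ (sym (lhs y ry k)) (sym (rhs x rx ry k)) le))
  where
  lhs : ∀ y ry k → y + 4 + (ry + 2 * k) ≡ y + ry + 2 * k + 4
  lhs = solve-∀
  rhs : ∀ x rx ry k → x + rx + ry + (ry + 2 * k) ≡ x + rx + 2 * (k + ry)
  rhs = solve-∀

consecutive-gap : ∀ x y ys → GapCond x y ⇔ Gap 4 (x + x % 2 + 2 * length (negatives (y ∷ ys)))
                                                   (y + y % 2 + 2 * length (negatives ys))
consecutive-gap x y ys = mk⇔
  (λ gc → subst (λ k → Gap 4 (x + x % 2 + 2 * k) qy) (sym (length-shift (y % 2) ν))
            (Equivalence.to (gap-lift x y (x % 2) (y % 2) (length ν)) (gapCond⇒ gc)))
  (λ gap → gapCond⇐ (Equivalence.from (gap-lift x y (x % 2) (y % 2) (length ν))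
            (subst (λ k → Gap 4 (x + x % 2 + 2 * k) qy) (length-shift (y % 2) ν) gap)))
  where
  ν = negatives ys
  qy = y + y % 2 + 2 * length ν

positives-gaps : ∀ {xs} → Linked GapCond xs → Linked (Gap 4) (positives xs)
positives-gaps []                        = []
positives-gaps [-]                       = [-]
positives-gaps {x ∷ y ∷ ys} (gc ∷ gcs) =
  Equivalence.to (consecutive-gap x y ys) gc ∷ positives-gaps gcs

positives-gaps⁻ : ∀ xs → Linked (Gap 4) (positives xs) → Linked GapCond xs
positives-gaps⁻ []           _            = []
positives-gaps⁻ (x ∷ [])     _            = [-]
positives-gaps⁻ (x ∷ y ∷ ys) (gap ∷ gaps) =
  Equivalence.from (consecutive-gap x y ys) gap ∷ positives-gaps⁻ (y ∷ ys) gaps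

positives-≥4 : ∀ {xs} → All (3 ≤_) xs → All (4 ≤_) (positives xs)
positives-≥4 []           = []
positives-≥4 (3≤x ∷ 3≤xs) = ≤-trans (3≤⇒4≤+%2 3≤x) (m≤m+n _ _) ∷ positives-≥4 3≤xs

positives-≥4⁻ : ∀ {xs} → Linked GapCond xs → All (4 ≤_) (positives xs) → All (3 ≤_) xs
positives-≥4⁻ []  [] = []
positives-≥4⁻ {x ∷ []} [-] (4≤p ∷ []) = 4≤+%2⇒3≤ (subst (4 ≤_) (+-identityʳ (x + x % 2)) 4≤p) ∷ []
positives-≥4⁻ {x ∷ y ∷ ys} ((y+2≤x , _) ∷ gcs) (_ ∷ 4≤ps) with positives-≥4⁻ gcs 4≤ps
... | 3≤y ∷ 3≤ys = ≤-trans 3≤y (≤-trans (m≤m+n y 2) y+2≤x) ∷ 3≤y ∷ 3≤ys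

fromSigned-toSigned : ∀ xs → fromSigned (positives xs) (negatives xs) ≡ xs
fromSigned-toSigned []       = refl
fromSigned-toSigned (x ∷ xs) rewrite unshift-shift (negatives xs) (%2≤1 x) =
  cong₂ _∷_ (trans (cong (_∸ (r + 2 * k)) (+-assoc x r (2 * k))) (m+n∸n≡m x (r + 2 * k)))
            (fromSigned-toSigned xs)
  where
  r = x % 2
  k = length (negatives xs)

toSigned-fromSigned : ∀ π ν → All Even π → Above stair π → OddSubset (length π) ν →
                      positives (fromSigned π ν) ≡ π × negatives (fromSigned π ν) ≡ ν
toSigned-fromSigned []      ν _ _ oddSubset = refl , sym (OddSubset-zero oddSubset)
toSigned-fromSigned (p ∷ π) ν (even-p ∷ evens) (stair≤p , above) oddSubset
  with OddSubset-shift⁻ ν oddSubset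
... | ν′ , b , b≤1 , oddSubset′ , refl rewrite unshift-shift ν′ b≤1
  with toSigned-fromSigned π ν′ evens above oddSubset′
... | positives≡ , negatives≡ = cong₂ _∷_ head≡p positives≡ , cong₂ shift parity≡b negatives≡
  where
  k = length ν′
  x = p ∸ (b + 2 * k)
  room : ∀ l → 1 + 2 * l ≤ stair l
  room l = ≤-trans (+-mono-≤ (m≤m+n 1 3) (*-monoˡ-≤ l (m≤m+n 2 2))) (≤-reflexive (sym (*-suc 4 l)))
  fits : b + 2 * k ≤ p
  fits = ≤-trans (+-mono-≤ b≤1 (*-monoʳ-≤ 2 (length-OddSubset (length π) oddSubset′)))
                 (≤-trans (room (length π)) stair≤p)
  x+b+2k≡p : x + b + 2 * k ≡ p
  x+b+2k≡p = trans (+-assoc x b (2 * k)) (m∸n+n≡m fits)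
  parity≡b : x % 2 ≡ b
  parity≡b = [m+b]%2≡0⇒m%2≡b x b≤1 (begin
    (x + b) % 2          ≡⟨ [m+kn]%n≡m%n (x + b) k 2 ⟨
    (x + b + k * 2) % 2  ≡⟨ cong (λ m → (x + b + m) % 2) (*-comm k 2) ⟩
    (x + b + 2 * k) % 2  ≡⟨ cong (_% 2) x+b+2k≡p ⟩
    p % 2                ≡⟨ n∣m⇒m%n≡0 p 2 even-p ⟩
    0                    ∎)
    where open ≡-Reasoning
  head≡p : x + x % 2 + 2 * length (negatives (fromSigned π ν′)) ≡ p
  head≡p = trans (cong₂ (λ r l → x + r + 2 * l) parity≡b (cong length negatives≡)) x+b+2k≡p

IsGG₂⇒IsGG'₋₂-toSigned : ∀ {n xs} → IsGG₂ n xs → IsGG'₋₂ n (toSigned xs)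
IsGG₂⇒IsGG'₋₂-toSigned {n} {xs} ((_ , sum≡n) , 3≤xs , gapConds) =
  ((All.map (≤-trans (s≤s z≤n)) fours , Linked.map Gap⇒≥ gaps) ,
   (All.map (λ (odd-q , _) → odd⇒positive odd-q) bounded , decreasing⇒nonincreasing decreasing) ,
   trans (sum-positives xs) (cong (_+ sum (negatives xs)) sum≡n)) ,
  All.zip (fours , positives-even xs) ,
  Linked.Linked⇒AllPairs Gap-trans gaps ,
  subst (λ l → All (λ q → Odd q × q + 1 ≤ 2 * l) (negatives xs)) (sym (length-positives xs)) bounded ,
  decreasing⇒unique decreasing
  where
  fours = positives-≥4 3≤xs
  gaps = positives-gaps gapConds
  decreasing = proj₁ (negatives-OddSubset xs)
  bounded = proj₂ (negatives-OddSubset xs)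

IsGG'₋₂-toSigned⇒IsGG₂ : ∀ {n xs} → IsGG'₋₂ n (toSigned xs) → IsGG₂ n xs
IsGG'₋₂-toSigned⇒IsGG₂ {n} {xs} ((_ , _ , sum≡) , fours-evens , gaps , _ , _) =
  ((All.map (≤-trans (s≤s z≤n)) threes , Linked.map (λ (y+2≤x , _) → Gap⇒≥ y+2≤x) gapConds) ,
   +-cancelʳ-≡ (sum (negatives xs)) (sum xs) n (trans (sym (sum-positives xs)) sum≡)) ,
  threes , gapConds
  where
  gapConds = positives-gaps⁻ xs (Linked.AllPairs⇒Linked gaps)
  threes = positives-≥4⁻ gapConds (All.map proj₁ fours-evens)

IsGG'₋₂-shape : ∀ {n π ν} → IsGG'₋₂ n (π , ν) → All Even π × Above stair π × OddSubset (length π) ν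
IsGG'₋₂-shape ((_ , (_ , nonincreasing) , _) , fours-evens , gaps , bounded , unique) =
  All.map proj₂ fours-evens ,
  gaps⇒Above-stair (Linked.AllPairs⇒Linked gaps) (All.map proj₁ fours-evens) ,
  nonincreasing-unique⇒decreasing nonincreasing unique , bounded

toSigned-bijection : ∀ n → BijectionBetween (IsGG₂ n) (IsGG'₋₂ n)
toSigned-bijection n = record
  { to      = toSigned
  ; from    = uncurry fromSigned
  ; to-P    = IsGG₂⇒IsGG'₋₂-toSigned
  ; from-Q  = λ gg → IsGG'₋₂-toSigned⇒IsGG₂ (subst (IsGG'₋₂ n) (sym (to∘from gg)) gg)
  ; from∘to = λ {xs} _ → fromSigned-toSigned xs
  ; to∘from = to∘from
  }
  where
  to∘from : ∀ {y} → IsGG'₋₂ n y → toSigned (uncurry fromSigned y) ≡ y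
  to∘from {π , ν} gg =
    let (evens , above , oddSubset) = IsGG'₋₂-shape gg
        (positives≡ , negatives≡) = toSigned-fromSigned π ν evens above oddSubset
    in cong₂ _,_ positives≡ negatives≡

-- GG'₋₂(n) = GG₋₂(n)

flatten : List ℕ → List ℕ
flatten π = rebase stair (λ _ → level (length π)) π

steepen : List ℕ → List ℕ
steepen π = rebase (λ _ → level (length π)) stair π

steepen-flatten : ∀ {π} → Above stair π → steepen (flatten π) ≡ π
steepen-flatten {π} above =
  trans (cong (λ l → rebase (λ _ → level l) stair (flatten π)) (length-rebase stair _ π))
        (rebase-rebase stair (λ _ → level (length π)) above)

flatten-steepen : ∀ {π} → All (level (length π) ≤_) π → flatten (steepen π) ≡ π
flatten-steepen {π} levels =
  trans (cong (λ l → rebase stair (λ _ → level l) (steepen π)) (length-rebase _ stair π))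
        (rebase-rebase (λ _ → level (length π)) stair (All⇒Above-const levels))

sum-flatten : ∀ {π} → Above stair π → sum (flatten π) ≡ sum π
sum-flatten {π} above = +-cancelʳ-≡ _ (sum (flatten π)) (sum π)
  (trans (sum-rebase stair _ above) (cong (sum π +_) (sym (stairs-balance (length π)))))

sum-steepen : ∀ {π} → All (level (length π) ≤_) π → sum (steepen π) ≡ sum π
sum-steepen {π} levels = +-cancelʳ-≡ _ (sum (steepen π)) (sum π)
  (trans (sum-rebase _ stair (All⇒Above-const levels)) (cong (sum π +_) (stairs-balance (length π))))

IsGG'₋₂⇒IsGG₋₂-flatten : ∀ {n π ν} → IsGG'₋₂ n (π , ν) → IsGG₋₂ n (flatten π , ν)
IsGG'₋₂⇒IsGG₋₂-flatten {n} {π} {ν} gg@((_ , partition-ν , sum≡) , _ , gaps , bounded , unique) =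
  ((All.map (≤-trans (1≤level l)) levels ,
    Linked.map (Gap⇒≥ {0})
      (rebase-gaps stair (λ _ → level l) stair-suc (λ _ → refl) (Linked.AllPairs⇒Linked gaps))) ,
   partition-ν ,
   trans (sum-flatten above) sum≡) ,
  subst (λ l′ → All (λ p → Even p × 2 * (l′ + 1) ≤ p) (flatten π)) (sym |flatten|≡l)
    (All.zip (rebase-even stair _ even-stair (λ _ → even-level l) above evens , levels)) ,
  subst (λ l′ → All (λ q → Odd q × q ≤ 2 * l′) ν) (sym |flatten|≡l)
    (All.map (λ {q} (odd-q , q+1≤2l) → odd-q , ≤-trans (m≤m+n q 1) q+1≤2l) bounded) ,
  unique
  where
  l = length π
  evens = proj₁ (IsGG'₋₂-shape gg)
  above = proj₁ (proj₂ (IsGG'₋₂-shape gg))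
  levels = Above-const⇒All (rebase-Above stair (λ _ → level l) π)
  |flatten|≡l = length-rebase stair _ π

IsGG₋₂⇒IsGG'₋₂-steepen : ∀ {n π ν} → IsGG₋₂ n (π , ν) → IsGG'₋₂ n (steepen π , ν)
IsGG₋₂⇒IsGG'₋₂-steepen {n} {π} {ν}
  (((_ , nonincreasing) , partition-ν , sum≡) , evens-levels , bounded , unique) =
  ((All.map (≤-trans (m≤m+n 1 3)) fours , Linked.map Gap⇒≥ gaps) ,
   partition-ν ,
   trans (sum-steepen levels) sum≡) ,
  All.zip (fours , rebase-even _ stair (λ _ → even-level l) even-stair (All⇒Above-const levels) evens) ,
  Linked.Linked⇒AllPairs Gap-trans gaps ,
  subst (λ l′ → All (λ q → Odd q × q + 1 ≤ 2 * l′) ν) (sym (length-rebase _ stair π))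
    (All.map (λ (odd-q , q≤2l) → odd-q , odd-≤-2* l odd-q q≤2l) bounded) ,
  unique
  where
  l = length π
  evens = All.map proj₁ evens-levels
  levels = All.map proj₂ evens-levels
  fours = Above-stair⇒All (rebase-Above (λ _ → level l) stair π)
  gaps = rebase-gaps (λ _ → level l) stair (λ _ → refl) stair-suc
           (Linked.map ≥⇒Gap0 nonincreasing)

staircase-bijection : ∀ n → BijectionBetween (IsGG'₋₂ n) (IsGG₋₂ n)
staircase-bijection n = record
  { to      = map₁ flatten
  ; from    = map₁ steepen
  ; to-P    = IsGG'₋₂⇒IsGG₋₂-flatten
  ; from-Q  = IsGG₋₂⇒IsGG'₋₂-steepen
  ; from∘to = λ gg → cong (_, _) (steepen-flatten (proj₁ (proj₂ (IsGG'₋₂-shape gg))))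
  ; to∘from = λ (_ , evens-levels , _) → cong (_, _) (flatten-steepen (All.map proj₂ evens-levels))
  }

theorem4p3 : (n : ℕ) → Σ ℕ λ k → HasCount (IsGG₂ n) k × HasCount (IsGG₋₂ n) k × HasCount (IsGG'₋₂ n) k
theorem4p3 n =
  let (k , countGG₂) = GG₂-hasCount n
      countGG'₋₂     = BijectionBetween.hasCount-transfer (toSigned-bijection n) countGG₂
  in k , countGG₂ , BijectionBetween.hasCount-transfer (staircase-bijection n) countGG'₋₂ , countGG'₋₂
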